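{- Let $F_2$ be the free group on generators $a,b$, $S=\{e,a,b\}$ and $L_n=\{e,a,a^2,\dots,a^{n-1}\}$. Then for all $n\ge1$, the $S$-solitaire orbit of $L_n$ has cardinality \[|\mathcal{O}(L_n)|=\frac{1}{2^n\sqrt5}\left((3+\sqrt5)^n-(3-\sqrt5)^n\right).\]
   Context: An $S$-solitaire move is a pair $(P,Q)$ of subsets of $F_2$ such that for some $g\in F_2$, $|P\cap gS|=|Q\cap gS|=|S|-1$ and $P\triangle Q$ is a $2$-element subset of $gS$. $\mathcal{O}(L_n)$ is the set of patterns reachable from $L_n$ by finitely many moves. -}

module Defs where

open import Data.Bool using (Bool; true; false; _∧_; _∨_; not; _xor_; T; if_then_else_)
open import Data.Nat using (ℕ; zero; suc; _<ᵇ_)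
open import Data.Integer as ℤ using (ℤ; +_)
open import Data.List using (List; []; _∷_; length; filter; map; upTo; replicate)
open import Data.Bool.ListAction using (any)
open import Data.Product using (Σ; _,_; proj₁; ∃; _×_)
open import Data.Sum using (_⊎_)
open import Data.Unit using (tt)
open import Relation.Nullary using (¬_; Dec; yes; no; does)
open import Relation.Binary.PropositionalEquality using (_≡_; refl; _≢_)
open import Relation.Binary.Construct.Closure.ReflexiveTransitive using (Star)

data Letter : Set where
  a⁺ a⁻ b⁺ b⁻ : Letter

inv : Letter → Letter
inv a⁺ = a⁻
inv a⁻ = a⁺
inv b⁺ = b⁻
inv b⁻ = b⁺

_==_ : Letter → Letter → Bool
a⁺ == a⁺ = true
a⁻ == a⁻ = true
b⁺ == b⁺ = true
b⁻ == b⁻ = true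
_  == _  = false

-- Words are stored REVERSED: the head of the list is the rightmost letter.
Word : Set
Word = List Letter

isReduced : Word → Bool
isReduced [] = true
isReduced (x ∷ []) = true
isReduced (x ∷ y ∷ w) = not (y == inv x) ∧ isReduced (y ∷ w)

F₂ : Set
F₂ = Σ Word (λ w → T (isReduced w))

e : F₂
e = [] , tt

private
  tailRed : ∀ y w → T (isReduced (y ∷ w)) → T (isReduced w)
  tailRed y [] r = tt
  tailRed y (z ∷ w) r with not (z == inv y)
  ... | true = r

  consRed : ∀ x y w → T (not (y == inv x)) → T (isReduced (y ∷ w)) →
            T (isReduced (x ∷ y ∷ w))
  consRed x y w p r with not (y == inv x)
  ... | true = r

_·_ : F₂ → Letter → F₂
([] , r) · x = (x ∷ []) , tt
((y ∷ w) , r) · x with y == inv x in eq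
... | true  = w , tailRed y w r
... | false = (x ∷ y ∷ w) , consRed x y w (helper eq) r
  where
    helper : ∀ {c} → c ≡ false → T (not c)
    helper refl = tt

_=w_ : Word → Word → Bool
[] =w [] = true
(x ∷ v) =w (y ∷ w) = (x == y) ∧ (v =w w)
_ =w _ = false

_=F_ : F₂ → F₂ → Bool
(v , _) =F (w , _) = v =w w

Pattern : Set
Pattern = F₂ → Bool

-- The translate gS of S = {e, a, b}, as the list [g, ga, gb]
-- (these three elements are pairwise distinct).
gS : F₂ → List F₂
gS g = g ∷ (g · a⁺) ∷ (g · b⁺) ∷ []

_∈gS_ : F₂ → F₂ → Set
x ∈gS g = T (any (λ y → x =F y) (gS g))

count : Pattern → F₂ → ℕ
count P g = length (filter (λ x → T? (P x)) (gS g))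
  where
    T? : (b : Bool) → Dec (T b)
    T? true  = yes tt
    T? false = no (λ ())

Move : Pattern → Pattern → Set
Move P Q = ∃ λ (g : F₂) →
  count P g ≡ 2 × count Q g ≡ 2 ×
  (∃ λ (x : F₂) → ∃ λ (y : F₂) →
     x ∈gS g × y ∈gS g × x ≢ y ×
     (∀ z → T (P z xor Q z) → (z ≡ x ⊎ z ≡ y)) ×
     T (P x xor Q x) × T (P y xor Q y))

Reachable : Pattern → Pattern → Set
Reachable = Star Move

powA : ℕ → F₂
powA zero = e
powA (suc i) = powA i · a⁺

L : ℕ → Pattern
L n g = any (λ i → g =F powA i) (upTo n)

_≈P_ : Pattern → Pattern → Set
P ≈P Q = ∀ g → P g ≡ Q g

-- ℤ[√5]: the pair (p , q) stands for p + q√5.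

ℤ√5 : Set
ℤ√5 = ℤ × ℤ

_-₅_ : ℤ√5 → ℤ√5 → ℤ√5
(p , q) -₅ (r , s) = (p ℤ.- r) , (q ℤ.- s)

_*₅_ : ℤ√5 → ℤ√5 → ℤ√5
(p , q) *₅ (r , s) = (p ℤ.* r ℤ.+ + 5 ℤ.* q ℤ.* s) , (p ℤ.* s ℤ.+ q ℤ.* r)

_^₅_ : ℤ√5 → ℕ → ℤ√5
x ^₅ zero = (+ 1) , (+ 0)
x ^₅ suc n = x *₅ (x ^₅ n)

-- Every pattern reachable from Lₙ lives on the comb aʲ (j < n), aʲb (j < n − 1), a union of the
-- triangles aʲS; a move refills a triangle holding exactly two of its three points so that it again
-- holds two. A three-state automaton reading a comb pattern from its far end does not notice such a
-- refilling, and every pattern it accepts can be moved back to Lₙ, so the orbit is exactly its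
-- language. Counting accepted patterns gives a' = a + c, c' = a + 2c, hence |𝒪(Lₙ)| = F(2n), and
-- (3 ± √5)ⁿ = 2ⁿ⁻¹(x ± F(2n)√5) gives the closed form.
module Submission where

open import Defs
open import Data.Bool as Bool using (Bool; true; false; _xor_; T; if_then_else_)
open import Data.Bool.Properties using (T-∧; T-irrelevant; xor-same; xor-comm)
open import Data.Empty using (⊥; ⊥-elim)
open import Data.Integer using (+_; -1ℤ)
import Data.Integer as ℤ
import Data.Integer.Properties as ℤ
import Data.Integer.Tactic.RingSolver as ℤ-Solver
open import Data.List using (List; []; _∷_; _++_; length; map; upTo; replicate)
open import Data.List.Properties using (length-++; length-map)
open import Data.List.Membership.Propositional using (_∈_; find; lose)
open import Data.List.Membership.Propositional.Properties
  using (∈-++⁺ˡ; ∈-++⁺ʳ; ∈-++⁻; ∈-map⁺; ∈-map⁻; ∈-upTo⁺; ∈-upTo⁻)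
open import Data.List.Relation.Binary.Disjoint.Propositional using (Disjoint)
open import Data.List.Relation.Unary.All using (All)
import Data.List.Relation.Unary.All as All
import Data.List.Relation.Unary.All.Properties as All
open import Data.List.Relation.Unary.AllPairs using (AllPairs)
import Data.List.Relation.Unary.AllPairs as AllPairs
import Data.List.Relation.Unary.AllPairs.Properties as AllPairs
open import Data.List.Relation.Unary.Any using (Any; here; there)
open import Data.List.Relation.Unary.Any.Properties as Any using (any⁺; any⁻)
open import Data.List.Relation.Unary.Unique.Propositional using (Unique)
import Data.List.Relation.Unary.Unique.Propositional.Properties as Unique
open import Data.Maybe using (Maybe; just; nothing; maybe)
open import Data.Maybe.Properties using (just-injective)
open import Data.Nat using (ℕ; zero; suc; _+_; _*_; _^_; _≤_; _<_; z≤n; s≤s)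
import Data.Nat.Properties as ℕ
import Data.Nat.Tactic.RingSolver as ℕ-Solver
open import Data.Product using (∃; ∃₂; _×_; _,_; proj₁; proj₂)
open import Data.Sum using (_⊎_; inj₁; inj₂; [_,_]′)
import Data.Sum as Sum
open import Data.Unit using (tt)
open import Function using (_∘_; Equivalence)
open import Relation.Binary.Construct.Closure.ReflexiveTransitive
  using (Star; ε; _◅_; _◅◅_; gmap; reverse)
open import Relation.Binary.Definitions using (DecidableEquality)
open import Relation.Binary.PropositionalEquality
  using (_≡_; _≢_; refl; sym; trans; cong; cong₂; cong-app; subst; module ≡-Reasoning)
open import Relation.Nullary using (¬_; yes; no; does)

==⇒≡ : ∀ x y → T (x == y) → x ≡ y
==⇒≡ a⁺ a⁺ _ = refl
==⇒≡ a⁻ a⁻ _ = refl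
==⇒≡ b⁺ b⁺ _ = refl
==⇒≡ b⁻ b⁻ _ = refl
==⇒≡ a⁺ a⁻ ()
==⇒≡ a⁺ b⁺ ()
==⇒≡ a⁺ b⁻ ()
==⇒≡ a⁻ a⁺ ()
==⇒≡ a⁻ b⁺ ()
==⇒≡ a⁻ b⁻ ()
==⇒≡ b⁺ a⁺ ()
==⇒≡ b⁺ a⁻ ()
==⇒≡ b⁺ b⁻ ()
==⇒≡ b⁻ a⁺ ()
==⇒≡ b⁻ a⁻ ()
==⇒≡ b⁻ b⁺ ()

==-refl : ∀ x → T (x == x)
==-refl a⁺ = tt
==-refl a⁻ = tt
==-refl b⁺ = tt
==-refl b⁻ = tt

=w⇒≡ : ∀ v w → T (v =w w) → v ≡ w
=w⇒≡ [] [] _ = refl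
=w⇒≡ (x ∷ v) (y ∷ w) t =
  let x==y , v=w = Equivalence.to T-∧ t in cong₂ _∷_ (==⇒≡ x y x==y) (=w⇒≡ v w v=w)

=w-refl : ∀ w → T (w =w w)
=w-refl [] = tt
=w-refl (x ∷ w) = Equivalence.from T-∧ (==-refl x , =w-refl w)

F₂-≡ : ∀ {g h : F₂} → proj₁ g ≡ proj₁ h → g ≡ h
F₂-≡ {w , r} {.w , r′} refl = cong (w ,_) (T-irrelevant r r′)

=F⇒≡ : ∀ g h → T (g =F h) → g ≡ h
=F⇒≡ (v , _) (w , _) t = F₂-≡ (=w⇒≡ v w t)

=F-refl : ∀ g → T (g =F g)
=F-refl (w , _) = =w-refl w

_≟F_ : DecidableEquality F₂
g ≟F h with g =F h in eq
... | true  = yes (=F⇒≡ g h (subst T (sym eq) tt))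
... | false = no λ { refl → subst T eq (=F-refl g) }

T-ext : ∀ {u v} → (T u → T v) → (T v → T u) → u ≡ v
T-ext {true}  {true}  _ _ = refl
T-ext {true}  {false} f _ = ⊥-elim (f tt)
T-ext {false} {true}  _ g = ⊥-elim (g tt)
T-ext {false} {false} _ _ = refl

xor≡false⇒≡ : ∀ {u v} → u xor v ≡ false → u ≡ v
xor≡false⇒≡ {true}  {true}  _ = refl
xor≡false⇒≡ {false} {false} _ = refl

data Corner : Set where
  ce ca cb : Corner

_·ᶜ_ : F₂ → Corner → F₂
g ·ᶜ ce = g
g ·ᶜ ca = g · a⁺
g ·ᶜ cb = g · b⁺

∈gS⇒corner : ∀ {x g} → x ∈gS g → ∃ λ ρ → x ≡ g ·ᶜ ρ
∈gS⇒corner {x} {g} x∈ with any⁻ (x =F_) (gS g) x∈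
... | here t                 = ce , =F⇒≡ x _ t
... | there (here t)         = ca , =F⇒≡ x _ t
... | there (there (here t)) = cb , =F⇒≡ x _ t

corner∈gS : ∀ g ρ → (g ·ᶜ ρ) ∈gS g
corner∈gS g ρ = any⁺ ((g ·ᶜ ρ) =F_) (lose (corner∈ ρ) (=F-refl (g ·ᶜ ρ)))
  where
  corner∈ : ∀ ρ → g ·ᶜ ρ ∈ gS g
  corner∈ ce = here refl
  corner∈ ca = there (here refl)
  corner∈ cb = there (there (here refl))

allBut : Corner → Corner → Bool
allBut ce ce = false
allBut ca ca = false
allBut cb cb = false
allBut _  _  = true

-- A triangle meeting a pattern in exactly two of its three corners is described by the missing one.
Hole : (Corner → Bool) → Corner → Set
Hole t κ = ∀ ρ → t ρ ≡ allBut κ ρ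

allBut-self : ∀ κ → allBut κ κ ≡ false
allBut-self ce = refl
allBut-self ca = refl
allBut-self cb = refl

allBut-false : ∀ κ ρ → allBut κ ρ ≡ false → ρ ≡ κ
allBut-false ce ce _ = refl
allBut-false ca ca _ = refl
allBut-false cb cb _ = refl
allBut-false ce ca ()
allBut-false ce cb ()
allBut-false ca ce ()
allBut-false ca cb ()
allBut-false cb ce ()
allBut-false cb ca ()

allBut-true : ∀ {κ ρ} → ρ ≢ κ → allBut κ ρ ≡ true
allBut-true {κ} {ρ} ρ≢κ with allBut κ ρ in eq
... | true  = refl
... | false = ⊥-elim (ρ≢κ (allBut-false κ ρ eq))

Hole-unique-false : ∀ {t κ ρ ρ′} → Hole t κ → t ρ ≡ false → t ρ′ ≡ false → ρ ≡ ρ′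
Hole-unique-false {κ = κ} {ρ} {ρ′} h tρ tρ′ =
  trans (allBut-false κ ρ (trans (sym (h ρ)) tρ)) (sym (allBut-false κ ρ′ (trans (sym (h ρ′)) tρ′)))

allBut-xor⁻ : ∀ κ κ′ ρ → T (allBut κ ρ xor allBut κ′ ρ) → ρ ≡ κ ⊎ ρ ≡ κ′
allBut-xor⁻ κ κ′ ρ t with allBut κ ρ in eq | allBut κ′ ρ in eq′
... | false | true  = inj₁ (allBut-false κ ρ eq)
... | true  | false = inj₂ (allBut-false κ′ ρ eq′)

allBut-xor⁺ : ∀ {κ κ′ ρ} → κ ≢ κ′ → ρ ≡ κ ⊎ ρ ≡ κ′ →
              T (allBut κ ρ xor allBut κ′ ρ)
allBut-xor⁺ {κ} κ≢κ′ (inj₁ refl) rewrite allBut-self κ | allBut-true κ≢κ′ = tt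
allBut-xor⁺ {κ′ = κ′} κ≢κ′ (inj₂ refl)
  rewrite allBut-self κ′ | allBut-true (κ≢κ′ ∘ sym) = tt

count≡2⇒Hole : ∀ (P : Pattern) g → count P g ≡ 2 → ∃ (Hole (λ ρ → P (g ·ᶜ ρ)))
count≡2⇒Hole P g two with P g in e
count≡2⇒Hole P g two | true with P (g · a⁺) in a
count≡2⇒Hole P g two | true | true with P (g · b⁺) in b
count≡2⇒Hole P g ()  | true | true | true
count≡2⇒Hole P g _   | true | true | false = cb , λ { ce → e ; ca → a ; cb → b }
count≡2⇒Hole P g two | true | false with P (g · b⁺) in b
count≡2⇒Hole P g _   | true | false | true = ca , λ { ce → e ; ca → a ; cb → b }
count≡2⇒Hole P g ()  | true | false | false
count≡2⇒Hole P g two | false with P (g · a⁺) in a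
count≡2⇒Hole P g two | false | true with P (g · b⁺) in b
count≡2⇒Hole P g _   | false | true | true = ce , λ { ce → e ; ca → a ; cb → b }
count≡2⇒Hole P g ()  | false | true | false
count≡2⇒Hole P g two | false | false with P (g · b⁺)
count≡2⇒Hole P g ()  | false | false | true
count≡2⇒Hole P g ()  | false | false | false

Hole⇒count≡2 : ∀ (P : Pattern) g {κ} → Hole (λ ρ → P (g ·ᶜ ρ)) κ → count P g ≡ 2
Hole⇒count≡2 P g {ce} h rewrite h ce | h ca | h cb = refl
Hole⇒count≡2 P g {ca} h rewrite h ce | h ca | h cb = refl
Hole⇒count≡2 P g {cb} h rewrite h ce | h ca | h cb = refl

Move-sym : ∀ {P Q} → Move P Q → Move Q P
Move-sym {P} {Q} (g , cP , cQ , x , y , x∈ , y∈ , x≢y , onlyXY , dx , dy) =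
  g , cQ , cP , x , y , x∈ , y∈ , x≢y ,
  (λ z t → onlyXY z (subst T (xor-comm (Q z) (P z)) t)) ,
  subst T (xor-comm (P x) (Q x)) dx , subst T (xor-comm (P y) (Q y)) dy

Move-respˡ : ∀ {P P′ Q} → P ≈P P′ → Move P Q → Move P′ Q
Move-respˡ {P} {P′} {Q} P≈P′ (g , cP , cQ , x , y , x∈ , y∈ , x≢y , onlyXY , dx , dy) =
  g , Hole⇒count≡2 P′ g (λ ρ → trans (sym (P≈P′ (g ·ᶜ ρ))) (hP ρ)) , cQ ,
  x , y , x∈ , y∈ , x≢y ,
  (λ z t → onlyXY z (subst T (cong (_xor Q z) (sym (P≈P′ z))) t)) ,
  subst T (cong (_xor Q x) (P≈P′ x)) dx , subst T (cong (_xor Q y) (P≈P′ y)) dy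
  where hP = proj₂ (count≡2⇒Hole P g cP)

-- The comb {aʲ} ∪ {aʲ b}

data Point : Set where
  stem tooth : ℕ → Point

↑ : Point → Point
↑ (stem j)  = stem (suc j)
↑ (tooth j) = tooth (suc j)

-- Words are stored reversed, so aʲ b is b⁺ ∷ aʲ.
word : Point → Word
word (stem j)  = replicate j a⁺
word (tooth j) = b⁺ ∷ replicate j a⁺

afterA afterB : Maybe Point → Maybe Point
afterA (just (stem j)) = just (stem (suc j))
afterA _               = nothing
afterB (just (stem j)) = just (tooth j)
afterB _               = nothing

locate : Word → Maybe Point
locate []       = just (stem 0)
locate (a⁺ ∷ w) = afterA (locate w)
locate (b⁺ ∷ w) = afterB (locate w)
locate (a⁻ ∷ _) = nothing
locate (b⁻ ∷ _) = nothing

locate-aʲ : ∀ j → locate (replicate j a⁺) ≡ just (stem j)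
locate-aʲ zero    = refl
locate-aʲ (suc j) = cong afterA (locate-aʲ j)

locate-word : ∀ p → locate (word p) ≡ just p
locate-word (stem j)  = locate-aʲ j
locate-word (tooth j) = cong afterB (locate-aʲ j)

locate⇒word : ∀ w {p} → locate w ≡ just p → word p ≡ w
locate⇒word [] refl = refl
locate⇒word (a⁺ ∷ w) eq with locate w in eq′
locate⇒word (a⁺ ∷ w) refl | just (stem j) = cong (a⁺ ∷_) (locate⇒word w eq′)
locate⇒word (b⁺ ∷ w) eq with locate w in eq′
locate⇒word (b⁺ ∷ w) refl | just (stem j) = cong (b⁺ ∷_) (locate⇒word w eq′)

word-injective : ∀ {p q} → word p ≡ word q → p ≡ q
word-injective {p} {q} e = just-injective (trans (sym (locate-word p)) (trans (cong locate e) (locate-word q)))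

afterA-afterB : ∀ m → afterA (afterB m) ≡ nothing
afterA-afterB (just (stem _))  = refl
afterA-afterB (just (tooth _)) = refl
afterA-afterB nothing          = refl

afterB-afterB : ∀ m → afterB (afterB m) ≡ nothing
afterB-afterB (just (stem _))  = refl
afterB-afterB (just (tooth _)) = refl
afterB-afterB nothing          = refl

stem-injective : ∀ {i j} → stem i ≡ stem j → i ≡ j
stem-injective refl = refl

tri : ℕ → Corner → Point
tri i ce = stem i
tri i ca = stem (suc i)
tri i cb = tooth i

tri-injective : ∀ i {ρ ρ′} → tri i ρ ≡ tri i ρ′ → ρ ≡ ρ′
tri-injective i {ce} {ce} _ = refl
tri-injective i {ca} {ca} _ = refl
tri-injective i {cb} {cb} _ = refl
tri-injective i {ce} {ca} e = ⊥-elim (ℕ.1+n≢n (sym (stem-injective e)))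
tri-injective i {ca} {ce} e = ⊥-elim (ℕ.1+n≢n (stem-injective e))
tri-injective i {ce} {cb} ()
tri-injective i {ca} {cb} ()
tri-injective i {cb} {ce} ()
tri-injective i {cb} {ca} ()

aʲ·ᶜ : ∀ j (r : T (isReduced (replicate j a⁺))) ρ →
       proj₁ ((replicate j a⁺ , r) ·ᶜ ρ) ≡ word (tri j ρ)
aʲ·ᶜ j       r ce = refl
aʲ·ᶜ zero    r ca = refl
aʲ·ᶜ (suc j) r ca = refl
aʲ·ᶜ zero    r cb = refl
aʲ·ᶜ (suc j) r cb = refl

powA-word : ∀ i → proj₁ (powA i) ≡ word (stem i)
corner-word : ∀ i ρ → proj₁ (powA i ·ᶜ ρ) ≡ word (tri i ρ)

powA-word zero    = refl
powA-word (suc i) = corner-word i ca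

corner-word i ρ with powA i | powA-word i
... | w , r | refl = aʲ·ᶜ i r ρ

·ᶜ-injective : ∀ i {ρ ρ′} → powA i ·ᶜ ρ ≡ powA i ·ᶜ ρ′ → ρ ≡ ρ′
·ᶜ-injective i {ρ} {ρ′} e =
  tri-injective i (word-injective (trans (sym (corner-word i ρ)) (trans (cong proj₁ e) (corner-word i ρ′))))

corner? : ∀ i z → (∃ λ ρ → z ≡ powA i ·ᶜ ρ) ⊎ (∀ ρ → z ≢ powA i ·ᶜ ρ)
corner? i z with z ≟F (powA i ·ᶜ ce) | z ≟F (powA i ·ᶜ ca) | z ≟F (powA i ·ᶜ cb)
... | yes e | _     | _     = inj₁ (ce , e)
... | no _  | yes e | _     = inj₁ (ca , e)
... | no _  | no _  | yes e = inj₁ (cb , e)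
... | no e  | no a  | no b  = inj₂ λ { ce → e ; ca → a ; cb → b }

-- A code of length k lists the values x₀ … x_k on a⁰ … aᵏ and y₀ … y_{k-1}
-- on a⁰b … aᵏ⁻¹b; `cons x₀ y₀ c` puts c one step further up the comb.
data Code : ℕ → Set where
  end  : Bool → Code zero
  cons : ∀ {k} → Bool → Bool → Code k → Code (suc k)

value : ∀ {k} → Code k → Point → Bool
value (end x)      (stem zero)    = x
value (end _)      _              = false
value (cons x _ _) (stem zero)    = x
value (cons _ y _) (tooth zero)   = y
value (cons _ _ c) (stem (suc j)) = value c (stem j)
value (cons _ _ c) (tooth (suc j)) = value c (tooth j)

⟦_⟧ : ∀ {k} → Code k → Pattern
⟦ c ⟧ g = maybe (value c) false (locate (proj₁ g))

HoleAt : ∀ {k} → Code k → ℕ → Corner → Set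
HoleAt c i = Hole (value c ∘ tri i)

value-injective : ∀ {k} (c c′ : Code k) → (∀ p → value c p ≡ value c′ p) → c ≡ c′
value-injective (end x) (end x′) e = cong end (e (stem 0))
value-injective (cons x y c) (cons x′ y′ c′) e =
  trans (cong₂ (λ u v → cons u v c) (e (stem 0)) (e (tooth 0)))
        (cong (cons x′ y′) (value-injective c c′ λ { (stem j)  → e (stem (suc j))
                                                     ; (tooth j) → e (tooth (suc j)) }))

value-tri-suc : ∀ {k x y} (c : Code k) i ρ → value (cons x y c) (tri (suc i) ρ) ≡ value c (tri i ρ)
value-tri-suc c i ce = refl
value-tri-suc c i ca = refl
value-tri-suc c i cb = refl

HoleAt-cons⁻ : ∀ {k x y} {c : Code k} {i κ} → HoleAt (cons x y c) (suc i) κ → HoleAt c i κ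
HoleAt-cons⁻ {c = c} {i} h ρ = trans (sym (value-tri-suc c i ρ)) (h ρ)

HoleAt-cons⁺ : ∀ {k x y} {c : Code k} {i κ} → HoleAt c i κ → HoleAt (cons x y c) (suc i) κ
HoleAt-cons⁺ {c = c} {i} h ρ = trans (value-tri-suc c i ρ) (h ρ)

HoleAt⇒< : ∀ {k} {c : Code k} {i κ} → HoleAt c i κ → i < k
HoleAt⇒< {c = end x} {i} h
  with () ← Hole-unique-false {t = value (end x) ∘ tri i} {ρ = ca} {ρ′ = cb} h refl refl
HoleAt⇒< {c = cons x y c} {zero} h = s≤s z≤n
HoleAt⇒< {c = cons x y c} {suc i} h = s≤s (HoleAt⇒< {c = c} (HoleAt-cons⁻ {c = c} h))

⟦⟧-word : ∀ {k} (c : Code k) {g} p → proj₁ g ≡ word p → ⟦ c ⟧ g ≡ value c p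
⟦⟧-word c p e = cong (maybe (value c) false) (trans (cong locate e) (locate-word p))

⟦⟧-corner : ∀ {k} (c : Code k) i ρ → ⟦ c ⟧ (powA i ·ᶜ ρ) ≡ value c (tri i ρ)
⟦⟧-corner c i ρ = ⟦⟧-word c {powA i ·ᶜ ρ} (tri i ρ) (corner-word i ρ)

⟦⟧-injective : ∀ {k} {c c′ : Code k} → ⟦ c ⟧ ≈P ⟦ c′ ⟧ → c ≡ c′
⟦⟧-injective {c = c} {c′} e = value-injective c c′ value≡
  where
  value≡ : ∀ p → value c p ≡ value c′ p
  value≡ (stem j)  = trans (sym (⟦⟧-corner c j ce)) (trans (e (powA j)) (⟦⟧-corner c′ j ce))
  value≡ (tooth j) = trans (sym (⟦⟧-corner c j cb)) (trans (e (powA j · b⁺)) (⟦⟧-corner c′ j cb))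

setHead : ∀ {k} → Code k → Bool → Code k
setHead (end _)      x = end x
setHead (cons _ y c) x = cons x y c

-- A code too short to contain the triangle aⁱS is left unchanged.
setTriangle : ∀ {k} → Code k → ℕ → Corner → Code k
setTriangle (end x)      _       _ = end x
setTriangle (cons _ _ c) zero    κ = cons (allBut κ ce) (allBut κ cb) (setHead c (allBut κ ca))
setTriangle (cons x y c) (suc i) κ = cons x y (setTriangle c i κ)

setHead-head : ∀ {k} (c : Code k) x → value (setHead c x) (stem 0) ≡ x
setHead-head (end _)      x = refl
setHead-head (cons _ _ _) x = refl

setHead-other : ∀ {k} (c : Code k) x p → p ≢ stem 0 → value (setHead c x) p ≡ value c p
setHead-other c            x (stem zero)    p≢ = ⊥-elim (p≢ refl)
setHead-other (end _)      x (stem (suc j)) _  = refl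
setHead-other (end _)      x (tooth j)      _  = refl
setHead-other (cons _ _ _) x (stem (suc j)) _  = refl
setHead-other (cons _ _ _) x (tooth zero)    _  = refl
setHead-other (cons _ _ _) x (tooth (suc j)) _  = refl

↑-tri : ∀ i ρ → ↑ (tri i ρ) ≡ tri (suc i) ρ
↑-tri i ce = refl
↑-tri i ca = refl
↑-tri i cb = refl

setTriangle-tri : ∀ {k} (c : Code k) {i} κ → i < k → HoleAt (setTriangle c i κ) i κ
setTriangle-tri (cons _ _ c) {zero}  κ _         ce = refl
setTriangle-tri (cons _ _ c) {zero}  κ _         ca = setHead-head c (allBut κ ca)
setTriangle-tri (cons _ _ c) {zero}  κ _         cb = refl
setTriangle-tri (cons _ _ c) {suc i} κ (s≤s i<k) ρ =
  trans (value-tri-suc (setTriangle c i κ) i ρ) (setTriangle-tri c κ i<k ρ)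

setTriangle-other : ∀ {k} (c : Code k) i κ p → (∀ ρ → p ≢ tri i ρ) →
                    value (setTriangle c i κ) p ≡ value c p
setTriangle-other (end _)      _       _ _                    _   = refl
setTriangle-other (cons _ _ c) zero    κ (stem zero)          off = ⊥-elim (off ce refl)
setTriangle-other (cons _ _ c) zero    κ (stem (suc zero))    off = ⊥-elim (off ca refl)
setTriangle-other (cons _ _ c) zero    κ (stem (suc (suc j))) off = setHead-other c _ (stem (suc j)) λ ()
setTriangle-other (cons _ _ c) zero    κ (tooth zero)         off = ⊥-elim (off cb refl)
setTriangle-other (cons _ _ c) zero    κ (tooth (suc j))      off = setHead-other c _ (tooth j) λ ()
setTriangle-other (cons _ _ c) (suc i) κ (stem zero)          off = refl
setTriangle-other (cons _ _ c) (suc i) κ (tooth zero)         off = refl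
setTriangle-other (cons _ _ c) (suc i) κ (stem (suc j))       off =
  setTriangle-other c i κ (stem j) λ ρ e → off ρ (trans (cong ↑ e) (↑-tri i ρ))
setTriangle-other (cons _ _ c) (suc i) κ (tooth (suc j))      off =
  setTriangle-other c i κ (tooth j) λ ρ e → off ρ (trans (cong ↑ e) (↑-tri i ρ))

⟦⟧-setTriangle-corner : ∀ {k} (c : Code k) {i} κ → i < k →
                        Hole (λ ρ → ⟦ setTriangle c i κ ⟧ (powA i ·ᶜ ρ)) κ
⟦⟧-setTriangle-corner c {i} κ i<k ρ =
  trans (⟦⟧-corner (setTriangle c i κ) i ρ) (setTriangle-tri c κ i<k ρ)

⟦⟧-setTriangle-off : ∀ {k} (c : Code k) i κ z → (∀ ρ → z ≢ powA i ·ᶜ ρ) →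
                     ⟦ setTriangle c i κ ⟧ z ≡ ⟦ c ⟧ z
⟦⟧-setTriangle-off c i κ z off with locate (proj₁ z) in eq
... | nothing = refl
... | just p  = setTriangle-other c i κ p λ ρ p≡ →
  off ρ (F₂-≡ (trans (sym (locate⇒word _ eq)) (trans (cong word p≡) (sym (corner-word i ρ)))))

Hole-offComb : ∀ {k} (c : Code k) g {κ ρ ρ′} → Hole (λ σ → ⟦ c ⟧ (g ·ᶜ σ)) κ → ρ ≢ ρ′ →
               locate (proj₁ (g ·ᶜ ρ)) ≡ nothing → locate (proj₁ (g ·ᶜ ρ′)) ≡ nothing →
               ⊥
Hole-offComb c g h ρ≢ρ′ off off′ =
  ρ≢ρ′ (Hole-unique-false h (cong (maybe (value c) false) off) (cong (maybe (value c) false) off′))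

-- At least two of g, ga, gb lie on the comb, which forces g to be a power of a.
Hole⇒power : ∀ {k} (c : Code k) g {κ} → Hole (λ ρ → ⟦ c ⟧ (g ·ᶜ ρ)) κ →
             ∃ λ i → g ≡ powA i
Hole⇒power c ([] , _) h = 0 , F₂-≡ refl
Hole⇒power c (a⁺ ∷ w , r) h with locate w in eq
... | just (stem j)  =
  suc j , F₂-≡ (trans (cong (a⁺ ∷_) (sym (locate⇒word w eq))) (sym (powA-word (suc j))))
... | just (tooth j) =
  ⊥-elim (Hole-offComb c _ {ρ = ce} {ρ′ = cb} h (λ ()) (cong afterA eq) (cong (afterB ∘ afterA) eq))
... | nothing        =
  ⊥-elim (Hole-offComb c _ {ρ = ce} {ρ′ = cb} h (λ ()) (cong afterA eq) (cong (afterB ∘ afterA) eq))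
Hole⇒power c (a⁻ ∷ w , r) h = ⊥-elim (Hole-offComb c _ {ρ = ce} {ρ′ = cb} h (λ ()) refl refl)
Hole⇒power c (b⁺ ∷ w , r) h =
  ⊥-elim (Hole-offComb c _ {ρ = ca} {ρ′ = cb} h (λ ()) (afterA-afterB (locate w)) (afterB-afterB (locate w)))
Hole⇒power c (b⁻ ∷ w , r) h = ⊥-elim (Hole-offComb c _ {ρ = ce} {ρ′ = ca} h (λ ()) refl refl)

Move-setTriangle : ∀ {k} (c : Code k) i {κ κ′} → HoleAt c i κ → κ ≢ κ′ →
                   Move ⟦ c ⟧ ⟦ setTriangle c i κ′ ⟧
Move-setTriangle c i {κ} {κ′} h κ≢κ′ =
  powA i , Hole⇒count≡2 ⟦ c ⟧ (powA i) before , Hole⇒count≡2 ⟦ c′ ⟧ (powA i) after ,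
  powA i ·ᶜ κ , powA i ·ᶜ κ′ , corner∈gS (powA i) κ , corner∈gS (powA i) κ′ ,
  κ≢κ′ ∘ ·ᶜ-injective i , onlyHoles , changed (inj₁ refl) , changed (inj₂ refl)
  where
  c′ = setTriangle c i κ′
  before : Hole (λ ρ → ⟦ c ⟧ (powA i ·ᶜ ρ)) κ
  before ρ = trans (⟦⟧-corner c i ρ) (h ρ)
  after : Hole (λ ρ → ⟦ c′ ⟧ (powA i ·ᶜ ρ)) κ′
  after = ⟦⟧-setTriangle-corner c κ′ (HoleAt⇒< {c = c} h)
  diff : ∀ ρ → (⟦ c ⟧ (powA i ·ᶜ ρ) xor ⟦ c′ ⟧ (powA i ·ᶜ ρ)) ≡ (allBut κ ρ xor allBut κ′ ρ)
  diff ρ = cong₂ _xor_ (before ρ) (after ρ)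
  changed : ∀ {ρ} → ρ ≡ κ ⊎ ρ ≡ κ′ → T (⟦ c ⟧ (powA i ·ᶜ ρ) xor ⟦ c′ ⟧ (powA i ·ᶜ ρ))
  changed {ρ} at = subst T (sym (diff ρ)) (allBut-xor⁺ κ≢κ′ at)
  onlyHoles : ∀ z → T (⟦ c ⟧ z xor ⟦ c′ ⟧ z) → z ≡ powA i ·ᶜ κ ⊎ z ≡ powA i ·ᶜ κ′
  onlyHoles z t with corner? i z
  ... | inj₁ (ρ , refl) =
    Sum.map (cong (powA i ·ᶜ_)) (cong (powA i ·ᶜ_)) (allBut-xor⁻ κ κ′ ρ (subst T (diff ρ) t))
  ... | inj₂ off = ⊥-elim (subst T unchanged t)
    where
    unchanged : (⟦ c ⟧ z xor ⟦ c′ ⟧ z) ≡ false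
    unchanged = trans (cong (⟦ c ⟧ z xor_) (⟦⟧-setTriangle-off c i κ′ z off)) (xor-same (⟦ c ⟧ z))

Move⇒setTriangle : ∀ {k} (c : Code k) {Q} → Move ⟦ c ⟧ Q →
                   ∃₂ λ i κ → HoleAt c i κ × ∃ λ κ′ → ⟦ setTriangle c i κ′ ⟧ ≈P Q
Move⇒setTriangle c {Q} (g , cP , cQ , x , y , x∈ , y∈ , _ , onlyXY , _)
  with count≡2⇒Hole ⟦ c ⟧ g cP
... | κ , before with Hole⇒power c g before
... | i , refl with count≡2⇒Hole Q (powA i) cQ
... | κ′ , after = i , κ , holeAt , κ′ , agree
  where
  holeAt : HoleAt c i κ
  holeAt ρ = trans (sym (⟦⟧-corner c i ρ)) (before ρ)
  notCorner : ∀ {z u} → (∀ ρ → z ≢ powA i ·ᶜ ρ) → u ∈gS powA i → z ≢ u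
  notCorner off u∈ refl = let ρ , e = ∈gS⇒corner u∈ in off ρ e
  unchanged : ∀ z → (∀ ρ → z ≢ powA i ·ᶜ ρ) → ⟦ c ⟧ z ≡ Q z
  unchanged z off with ⟦ c ⟧ z xor Q z in eq
  ... | true  = ⊥-elim ([ notCorner off x∈ , notCorner off y∈ ]′ (onlyXY z (subst T (sym eq) tt)))
  ... | false = xor≡false⇒≡ eq
  agree : ⟦ setTriangle c i κ′ ⟧ ≈P Q
  agree z with corner? i z
  ... | inj₁ (ρ , refl) = trans (⟦⟧-setTriangle-corner c κ′ (HoleAt⇒< {c = c} holeAt) ρ) (sym (after ρ))
  ... | inj₂ off = trans (⟦⟧-setTriangle-off c i κ′ z off) (unchanged z off)

-- The automaton

-- The `complete` codes are those of the orbit of L; a `rootless` code has x₀ = false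
-- and becomes complete once x₀ is set.
data State : Set where
  rootless complete dead : State

start : Bool → State
start false = rootless
start true  = complete

step : State → Bool → Bool → State
step rootless false true  = rootless
step rootless true  true  = complete
step complete false false = rootless
step complete true  false = complete
step complete false true  = complete
step _        _     _     = dead

state : ∀ {k} → Code k → State
state (end x)      = start x
state (cons x y c) = step (state c) x y

-- The state reached after reading a two-hot triangle does not depend on its hole.
afterTriangle : State → Bool → State
afterTriangle rootless true  = complete
afterTriangle complete false = complete
afterTriangle _        _     = dead

step²-allBut : ∀ s y κ → step (step s (allBut κ ca) y) (allBut κ ce) (allBut κ cb) ≡ afterTriangle s y
step²-allBut rootless false ce = refl
step²-allBut rootless false ca = refl
step²-allBut rootless false cb = refl
step²-allBut rootless true  ce = refl
step²-allBut rootless true  ca = refl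
step²-allBut rootless true  cb = refl
step²-allBut complete false ce = refl
step²-allBut complete false ca = refl
step²-allBut complete false cb = refl
step²-allBut complete true  ce = refl
step²-allBut complete true  ca = refl
step²-allBut complete true  cb = refl
step²-allBut dead     _     _  = refl

step-start-allBut : ∀ κ → step (start (allBut κ ca)) (allBut κ ce) (allBut κ cb) ≡ complete
step-start-allBut ce = refl
step-start-allBut ca = refl
step-start-allBut cb = refl

state-setTriangle : ∀ {k} (c : Code k) i {κ} κ′ → HoleAt c i κ → state (setTriangle c i κ′) ≡ state c
state-setTriangle (end x) i κ′ h with () ← HoleAt⇒< {c = end x} h
state-setTriangle (cons x y (end x₁)) zero {κ} κ′ h
  rewrite h ce | h ca | h cb = trans (step-start-allBut κ′) (sym (step-start-allBut κ))
state-setTriangle (cons x y (cons x₁ y₁ c)) zero {κ} κ′ h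
  rewrite h ce | h ca | h cb = trans (step²-allBut (state c) y₁ κ′) (sym (step²-allBut (state c) y₁ κ))
state-setTriangle (cons x y c) (suc i) κ′ h =
  cong (λ s → step s x y) (state-setTriangle c i κ′ (HoleAt-cons⁻ {c = c} h))

rootless-head : ∀ {k} (c : Code k) → state c ≡ rootless → value c (stem 0) ≡ false
rootless-head (end false) _ = refl
rootless-head (cons x y c) e with state c
rootless-head (cons false _     c) _  | _        = refl
rootless-head (cons true  true  c) () | rootless
rootless-head (cons true  false c) () | rootless
rootless-head (cons true  true  c) () | complete
rootless-head (cons true  false c) () | complete
rootless-head (cons true  _     c) () | dead

rootless-setHead : ∀ {k} (c : Code k) → state c ≡ rootless → state (setHead c true) ≡ complete
rootless-setHead (end false) _ = refl
rootless-setHead (cons x y c) e with state c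
rootless-setHead (cons false true  c) _ | rootless = refl
rootless-setHead (cons false false c) _ | complete = refl
rootless-setHead (cons false false c) () | rootless
rootless-setHead (cons true  true  c) () | rootless
rootless-setHead (cons true  false c) () | rootless
rootless-setHead (cons false true  c) () | complete
rootless-setHead (cons true  true  c) () | complete
rootless-setHead (cons true  false c) () | complete
rootless-setHead (cons _     _     c) () | dead

data _⇝_ {k} : Code k → Code k → Set where
  refill : ∀ {c} i {κ κ′} → HoleAt c i κ → κ ≢ κ′ → c ⇝ setTriangle c i κ′

⇝-cons : ∀ {k x y} {c c′ : Code k} → c ⇝ c′ → cons x y c ⇝ cons x y c′
⇝-cons (refill {c} i h κ≢κ′) = refill (suc i) (HoleAt-cons⁺ {c = c} h) κ≢κ′

⇝⇒Move : ∀ {k} {c c′ : Code k} → c ⇝ c′ → Move ⟦ c ⟧ ⟦ c′ ⟧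
⇝⇒Move (refill {c} i h κ≢κ′) = Move-setTriangle c i h κ≢κ′

Lcode : ∀ k → Code k
Lcode zero    = end true
Lcode (suc k) = cons true false (Lcode k)

Lcode-head : ∀ k → value (Lcode k) (stem 0) ≡ true
Lcode-head zero    = refl
Lcode-head (suc k) = refl

setHead-Lcode : ∀ k → setHead (Lcode k) true ≡ Lcode k
setHead-Lcode zero    = refl
setHead-Lcode (suc k) = refl

state-Lcode : ∀ k → state (Lcode k) ≡ complete
state-Lcode zero    = refl
state-Lcode (suc k) = cong (λ s → step s true false) (state-Lcode k)

complete⇝*Lcode : ∀ {k} (c : Code k) → state c ≡ complete → Star _⇝_ c (Lcode k)
complete⇝*Lcode (end true) _ = ε
complete⇝*Lcode (cons x y c) e with state c in ec | e
complete⇝*Lcode (cons true false c) _ | complete | _ =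
  gmap (cons true false) ⇝-cons (complete⇝*Lcode c ec)
complete⇝*Lcode {suc k} (cons false true c) _ | complete | _ =
  gmap (cons false true) ⇝-cons (complete⇝*Lcode c ec) ◅◅ (raiseRoot ◅ ε)
  where
  raiseRoot : cons false true (Lcode k) ⇝ cons true false (Lcode k)
  raiseRoot = subst (cons false true (Lcode k) ⇝_) (cong (cons true false) (setHead-Lcode k))
                    (refill 0 {ce} {cb} (λ { ce → refl ; ca → Lcode-head k ; cb → refl }) λ ())
complete⇝*Lcode (cons true true c) _ | rootless | _ =
  refill 0 {ca} {cb} (λ { ce → refl ; ca → rootless-head c ec ; cb → refl }) (λ ()) ◅
  gmap (cons true false) ⇝-cons (complete⇝*Lcode (setHead c true) (rootless-setHead c ec))
complete⇝*Lcode (cons false false c) _ | rootless | ()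
complete⇝*Lcode (cons false true  c) _ | rootless | ()
complete⇝*Lcode (cons true  false c) _ | rootless | ()
complete⇝*Lcode (cons false false c) _ | complete | ()
complete⇝*Lcode (cons true  true  c) _ | complete | ()
complete⇝*Lcode (cons _     _     c) _ | dead     | ()

codes : (k : ℕ) → State → List (Code k)
codes zero    rootless = end false ∷ []
codes zero    complete = end true ∷ []
codes zero    dead     = []
codes (suc k) rootless = map (cons false true) (codes k rootless) ++ map (cons false false) (codes k complete)
codes (suc k) complete =
  map (cons true true) (codes k rootless) ++ map (cons true false) (codes k complete) ++
  map (cons false true) (codes k complete)
codes (suc k) dead     = []

∈-map-cons : ∀ {k x y s} {cs : List (Code k)} {c} → (∀ {r} → r ∈ cs → state r ≡ s) →
             c ∈ map (cons x y) cs → state c ≡ step s x y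
∈-map-cons {x = x} {y} sound c∈ with ∈-map⁻ (cons x y) c∈
... | r , r∈ , refl = cong (λ s → step s x y) (sound r∈)

codes-sound : ∀ {k s} {c : Code k} → c ∈ codes k s → state c ≡ s
codes-sound {zero} {rootless} (here refl) = refl
codes-sound {zero} {complete} (here refl) = refl
codes-sound {suc k} {rootless} c∈ with ∈-++⁻ (map (cons false true) (codes k rootless)) c∈
... | inj₁ c∈′ = ∈-map-cons (codes-sound {k}) c∈′
... | inj₂ c∈′ = ∈-map-cons (codes-sound {k}) c∈′
codes-sound {suc k} {complete} c∈ with ∈-++⁻ (map (cons true true) (codes k rootless)) c∈
... | inj₁ c∈′ = ∈-map-cons (codes-sound {k}) c∈′
... | inj₂ c∈′ with ∈-++⁻ (map (cons true false) (codes k complete)) c∈′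
...   | inj₁ c∈″ = ∈-map-cons (codes-sound {k}) c∈″
...   | inj₂ c∈″ = ∈-map-cons (codes-sound {k}) c∈″

codes-complete : ∀ {k} (c : Code k) → state c ≢ dead → c ∈ codes k (state c)
codes-complete (end false) _ = here refl
codes-complete (end true)  _ = here refl
codes-complete {suc k} (cons x y c) alive
  with state c | codes-complete c (alive ∘ cong (λ s → step s x y)) | alive
codes-complete {suc k} (cons false true  c) _ | rootless | c∈ | _ =
  ∈-++⁺ˡ (∈-map⁺ (cons false true) c∈)
codes-complete {suc k} (cons true  true  c) _ | rootless | c∈ | _ =
  ∈-++⁺ˡ (∈-map⁺ (cons true true) c∈)
codes-complete {suc k} (cons false false c) _ | complete | c∈ | _ =
  ∈-++⁺ʳ (map (cons false true) (codes k rootless)) (∈-map⁺ (cons false false) c∈)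
codes-complete {suc k} (cons true  false c) _ | complete | c∈ | _ =
  ∈-++⁺ʳ (map (cons true true) (codes k rootless)) (∈-++⁺ˡ (∈-map⁺ (cons true false) c∈))
codes-complete {suc k} (cons false true  c) _ | complete | c∈ | _ =
  ∈-++⁺ʳ (map (cons true true) (codes k rootless))
    (∈-++⁺ʳ (map (cons true false) (codes k complete)) (∈-map⁺ (cons false true) c∈))
codes-complete {suc k} (cons false false c) _ | rootless | _ | alive′ = ⊥-elim (alive′ refl)
codes-complete {suc k} (cons true  false c) _ | rootless | _ | alive′ = ⊥-elim (alive′ refl)
codes-complete {suc k} (cons true  true  c) _ | complete | _ | alive′ = ⊥-elim (alive′ refl)
codes-complete {suc k} (cons _     _     c) _ | dead     | _ | alive′ = ⊥-elim (alive′ refl)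

cons-injective : ∀ {k x y} {c c′ : Code k} → cons x y c ≡ cons x y c′ → c ≡ c′
cons-injective refl = refl

map-cons-disjoint : ∀ {k x y x′ y′} (cs cs′ : List (Code k)) →
                    (∀ {c c′} → cons x y c ≢ cons x′ y′ c′) →
                    Disjoint (map (cons x y) cs) (map (cons x′ y′) cs′)
map-cons-disjoint {x = x} {y} {x′} {y′} _ _ ≢ (c∈ , c∈′)
  with ∈-map⁻ (cons x y) c∈ | ∈-map⁻ (cons x′ y′) c∈′
... | _ , _ , refl | _ , _ , e = ≢ e

Disjoint-++ʳ : ∀ {A : Set} {xs ys zs : List A} → Disjoint xs ys → Disjoint xs zs → Disjoint xs (ys ++ zs)
Disjoint-++ʳ {ys = ys} xs#ys xs#zs (x∈xs , x∈ys++zs) with ∈-++⁻ ys x∈ys++zs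
... | inj₁ x∈ys = xs#ys (x∈xs , x∈ys)
... | inj₂ x∈zs = xs#zs (x∈xs , x∈zs)

codes-unique : ∀ k s → Unique (codes k s)
codes-unique zero    rootless = All.[] AllPairs.∷ AllPairs.[]
codes-unique zero    complete = All.[] AllPairs.∷ AllPairs.[]
codes-unique zero    dead     = AllPairs.[]
codes-unique (suc k) rootless =
  Unique.++⁺ (Unique.map⁺ cons-injective (codes-unique k rootless))
             (Unique.map⁺ cons-injective (codes-unique k complete))
             (map-cons-disjoint (codes k rootless) (codes k complete) λ ())
codes-unique (suc k) complete =
  Unique.++⁺ (Unique.map⁺ cons-injective (codes-unique k rootless))
    (Unique.++⁺ (Unique.map⁺ cons-injective (codes-unique k complete))
                (Unique.map⁺ cons-injective (codes-unique k complete))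
                (map-cons-disjoint (codes k complete) (codes k complete) λ ()))
    (Disjoint-++ʳ (map-cons-disjoint (codes k rootless) (codes k complete) λ ())
                  (map-cons-disjoint (codes k rootless) (codes k complete) λ ()))
codes-unique (suc k) dead     = AllPairs.[]

-- F (2k+1) and F (2k+2), for F the Fibonacci numbers.
fibOdd fibEven : ℕ → ℕ
fibOdd  zero    = 1
fibOdd  (suc k) = fibOdd k + fibEven k
fibEven zero    = 1
fibEven (suc k) = fibOdd k + (fibEven k + fibEven k)

length-map-++ : ∀ {A B : Set} (f : A → B) xs ys → length (map f xs ++ ys) ≡ length xs + length ys
length-map-++ f xs ys = trans (length-++ (map f xs)) (cong (_+ length ys) (length-map f xs))

length-codes : ∀ k → length (codes k rootless) ≡ fibOdd k × length (codes k complete) ≡ fibEven k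
length-codes zero = refl , refl
length-codes (suc k) with length-codes k
... | #rootless , #complete =
  trans (length-map-++ (cons false true) (codes k rootless) _)
        (cong₂ _+_ #rootless (trans (length-map (cons false false) (codes k complete)) #complete)) ,
  trans (length-map-++ (cons true true) (codes k rootless) _)
        (cong₂ _+_ #rootless
          (trans (length-map-++ (cons true false) (codes k complete) _)
                 (cong₂ _+_ #complete (trans (length-map (cons false true) (codes k complete)) #complete))))

-- Binet's formula

conj : ℤ√5 → ℤ√5
conj (p , q) = p , ℤ.- q

conj-*₅ : ∀ x y → conj (x *₅ y) ≡ conj x *₅ conj y
conj-*₅ (p , q) (r , s) = cong₂ _,_ (rational p q r s) (irrational p q r s)
  where
  rational : ∀ p q r s →
             p ℤ.* r ℤ.+ + 5 ℤ.* q ℤ.* s ≡ p ℤ.* r ℤ.+ + 5 ℤ.* (ℤ.- q) ℤ.* (ℤ.- s)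
  rational = ℤ-Solver.solve-∀
  irrational : ∀ p q r s → ℤ.- (p ℤ.* s ℤ.+ q ℤ.* r) ≡ p ℤ.* (ℤ.- s) ℤ.+ (ℤ.- q) ℤ.* r
  irrational = ℤ-Solver.solve-∀

conj-^₅ : ∀ x n → conj (x ^₅ n) ≡ conj x ^₅ n
conj-^₅ x zero    = refl
conj-^₅ x (suc n) = trans (conj-*₅ x (x ^₅ n)) (cong (conj x *₅_) (conj-^₅ x n))

-₅-conj : ∀ p q → (p , q) -₅ conj (p , q) ≡ (+ 0 , q ℤ.+ q)
-₅-conj p q = cong₂ _,_ (ℤ.+-inverseʳ p) (cong (λ v → q ℤ.+ v) (ℤ.neg-involutive q))

*₅-3+√5 : ∀ m n → (+ 3 , + 1) *₅ (+ m , + n) ≡ (+ (3 * m + 5 * n) , + (3 * n + m))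
*₅-3+√5 m n = cong₂ _,_
  (sym (trans (ℤ.pos-+ (3 * m) (5 * n)) (cong₂ ℤ._+_ (ℤ.pos-* 3 m) (ℤ.pos-* 5 n))))
  (trans (cong (λ v → + 3 ℤ.* + n ℤ.+ v) (ℤ.*-identityˡ (+ m)))
         (sym (trans (ℤ.pos-+ (3 * n) m) (cong (λ v → v ℤ.+ + m) (ℤ.pos-* 3 n)))))

^₅-3+√5 : ∀ k → (+ 3 , + 1) ^₅ suc k ≡ (+ (2 ^ k * (2 * fibOdd k + fibEven k)) , + (2 ^ k * fibEven k))
^₅-3+√5 zero    = refl
^₅-3+√5 (suc k) =
  trans (cong ((+ 3 , + 1) *₅_) (^₅-3+√5 k))
        (trans (*₅-3+√5 (2 ^ k * (2 * fibOdd k + fibEven k)) (2 ^ k * fibEven k))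
               (cong₂ (λ u v → + u , + v) (rational (2 ^ k) (fibOdd k) (fibEven k))
                                          (irrational (2 ^ k) (fibOdd k) (fibEven k))))
  where
  rational : ∀ t a c → 3 * (t * (2 * a + c)) + 5 * (t * c) ≡ (2 * t) * (2 * (a + c) + (a + (c + c)))
  rational = ℕ-Solver.solve-∀
  irrational : ∀ t a c → 3 * (t * c) + t * (2 * a + c) ≡ (2 * t) * (a + (c + c))
  irrational = ℕ-Solver.solve-∀

binet : ∀ k → (+ 0 , + (2 ^ suc k * fibEven k)) ≡ ((+ 3 , + 1) ^₅ suc k) -₅ ((+ 3 , -1ℤ) ^₅ suc k)
binet k = sym (begin
  φ -₅ ((+ 3 , -1ℤ) ^₅ suc k)      ≡⟨ cong (φ -₅_) (sym (conj-^₅ (+ 3 , + 1) (suc k))) ⟩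
  φ -₅ conj φ                       ≡⟨ cong (λ x → x -₅ conj x) (^₅-3+√5 k) ⟩
  (+ X , + Y) -₅ conj (+ X , + Y)   ≡⟨ -₅-conj (+ X) (+ Y) ⟩
  (+ 0 , + Y ℤ.+ + Y)               ≡⟨ cong (+ 0 ,_) (sym (ℤ.pos-+ Y Y)) ⟩
  (+ 0 , + (Y + Y))                 ≡⟨ cong (λ m → + 0 , + m) (double (2 ^ k) (fibEven k)) ⟩
  (+ 0 , + (2 ^ suc k * fibEven k)) ∎)
  where
  open ≡-Reasoning
  φ = (+ 3 , + 1) ^₅ suc k
  X = 2 ^ k * (2 * fibOdd k + fibEven k)
  Y = 2 ^ k * fibEven k
  double : ∀ t c → t * c + t * c ≡ (2 * t) * c
  double = ℕ-Solver.solve-∀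

-- The orbit of L

value-Lcode-stem : ∀ {k j} → j < suc k → value (Lcode k) (stem j) ≡ true
value-Lcode-stem {zero}  {zero}  _         = refl
value-Lcode-stem {zero}  {suc j} (s≤s ())
value-Lcode-stem {suc k} {zero}  _         = refl
value-Lcode-stem {suc k} {suc j} (s≤s j<) = value-Lcode-stem j<

value-Lcode⁻ : ∀ k p → T (value (Lcode k) p) → ∃ λ j → j < suc k × p ≡ stem j
value-Lcode⁻ zero    (stem zero)    _ = 0 , s≤s z≤n , refl
value-Lcode⁻ (suc k) (stem zero)    _ = 0 , s≤s z≤n , refl
value-Lcode⁻ (suc k) (stem (suc j)) t with value-Lcode⁻ k (stem j) t
... | j′ , j′< , refl = suc j′ , s≤s j′< , refl
value-Lcode⁻ (suc k) (tooth (suc j)) t with value-Lcode⁻ k (tooth j) t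
... | _ , _ , ()

L≈Lcode : ∀ k → L (suc k) ≈P ⟦ Lcode k ⟧
L≈Lcode k g = T-ext to from
  where
  to : T (L (suc k) g) → T (⟦ Lcode k ⟧ g)
  to t with find (any⁻ (λ i → g =F powA i) (upTo (suc k)) t)
  ... | i , i∈ , g=i = subst T (sym value≡true) tt
    where value≡true : ⟦ Lcode k ⟧ g ≡ true
          value≡true = trans (cong ⟦ Lcode k ⟧ (=F⇒≡ g (powA i) g=i))
                             (trans (⟦⟧-corner (Lcode k) i ce) (value-Lcode-stem (∈-upTo⁻ i∈)))
  from : T (⟦ Lcode k ⟧ g) → T (L (suc k) g)
  from t with locate (proj₁ g) in eq | t
  ... | just p | t′ with value-Lcode⁻ k p t′
  ...   | j , j< , refl =
    any⁺ (λ i → g =F powA i) (lose (∈-upTo⁺ j<) (subst (λ h → T (g =F h)) g≡aʲ (=F-refl g)))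
    where g≡aʲ : g ≡ powA j
          g≡aʲ = F₂-≡ (trans (sym (locate⇒word _ eq)) (sym (powA-word j)))

_≟ᶜ_ : ∀ {k} → DecidableEquality (Code k)
end x ≟ᶜ end x′ with x Bool.≟ x′
... | yes refl  = yes refl
... | no  x≢x′ = no λ { refl → x≢x′ refl }
cons x y c ≟ᶜ cons x′ y′ c′ with x Bool.≟ x′ | y Bool.≟ y′ | c ≟ᶜ c′
... | yes refl | yes refl | yes refl = yes refl
... | no  x≢x′ | _        | _        = no λ { refl → x≢x′ refl }
... | yes _    | no  y≢y′ | _        = no λ { refl → y≢y′ refl }
... | yes _    | yes _    | no  c≢c′ = no λ { refl → c≢c′ refl }

-- L n itself stands in for the pattern of its code, so that it is reachable by the empty path.
orbitPattern : ∀ k → Code k → Pattern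
orbitPattern k c = if does (c ≟ᶜ Lcode k) then L (suc k) else ⟦ c ⟧

orbitPattern≈ : ∀ k c → orbitPattern k c ≈P ⟦ c ⟧
orbitPattern≈ k c with c ≟ᶜ Lcode k
... | yes refl = L≈Lcode k
... | no  _    = λ _ → refl

-- P ≢ Q rules out the empty path, which would need P ≡ P′, i.e. function extensionality.
Reachable-respˡ : ∀ {P P′ Q} → P ≈P P′ → P ≢ Q → Reachable P Q → Reachable P′ Q
Reachable-respˡ _    P≢Q ε        = ⊥-elim (P≢Q refl)
Reachable-respˡ P≈P′ _   (m ◅ ms) = Move-respˡ P≈P′ m ◅ ms

orbitPattern-reachable : ∀ k (c : Code k) → state c ≡ complete →
                         Reachable (L (suc k)) (orbitPattern k c)
orbitPattern-reachable k c e with c ≟ᶜ Lcode k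
... | yes _   = ε
... | no  c≢L = Reachable-respˡ (sym ∘ L≈Lcode k) (λ eq → c≢L (sym (⟦⟧-injective (cong-app eq))))
                  (reverse (λ {P} {Q} → Move-sym {P} {Q}) (gmap ⟦_⟧ ⇝⇒Move (complete⇝*Lcode c e)))

OrbitCode : ℕ → Pattern → Set
OrbitCode k Q = ∃ λ (c : Code k) → state c ≡ complete × ⟦ c ⟧ ≈P Q

OrbitCode-Move : ∀ {k P Q} → OrbitCode k P → Move P Q → OrbitCode k Q
OrbitCode-Move (c , complete-c , c≈P) m with Move⇒setTriangle c (Move-respˡ (sym ∘ c≈P) m)
... | i , κ , h , κ′ , agree =
  setTriangle c i κ′ , trans (state-setTriangle c i κ′ h) complete-c , agree

OrbitCode-Reachable : ∀ {k P Q} → OrbitCode k P → Reachable P Q → OrbitCode k Q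
OrbitCode-Reachable o ε        = o
OrbitCode-Reachable o (m ◅ ms) = OrbitCode-Reachable (OrbitCode-Move o m) ms

orbit : ℕ → List Pattern
orbit k = map (orbitPattern k) (codes k complete)

orbit-reachable : ∀ k → All (Reachable (L (suc k))) (orbit k)
orbit-reachable k = All.map⁺ (All.tabulate λ {c} c∈ → orbitPattern-reachable k c (codes-sound c∈))

orbit-distinct : ∀ k → AllPairs (λ P Q → ¬ (P ≈P Q)) (orbit k)
orbit-distinct k = AllPairs.map⁺ (AllPairs.map distinct (codes-unique k complete))
  where
  distinct : ∀ {c c′} → c ≢ c′ → ¬ (orbitPattern k c ≈P orbitPattern k c′)
  distinct {c} {c′} c≢c′ eq =
    c≢c′ (⟦⟧-injective λ g → trans (sym (orbitPattern≈ k c g)) (trans (eq g) (orbitPattern≈ k c′ g)))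

orbit-covers : ∀ k Q → Reachable (L (suc k)) Q → Any (λ P → P ≈P Q) (orbit k)
orbit-covers k Q r with OrbitCode-Reachable (Lcode k , state-Lcode k , sym ∘ L≈Lcode k) r
... | c , complete-c , c≈Q = Any.map⁺ (lose c∈ λ g → trans (orbitPattern≈ k c g) (c≈Q g))
  where
  c∈ : c ∈ codes k complete
  c∈ = subst (λ s → c ∈ codes k s) complete-c
             (codes-complete c λ c-dead → complete≢dead (trans (sym complete-c) c-dead))
    where complete≢dead : complete ≢ dead
          complete≢dead ()

length-orbit : ∀ k → length (orbit k) ≡ fibEven k
length-orbit k = trans (length-map (orbitPattern k) (codes k complete)) (proj₂ (length-codes k))

corollary4 : (n : ℕ) → 1 ≤ n →
    ∃ λ (orbit : List Pattern) →
      All (Reachable (L n)) orbit ×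
      AllPairs (λ P Q → ¬ (P ≈P Q)) orbit ×
      (∀ Q → Reachable (L n) Q → Any (λ P → P ≈P Q) orbit) ×
      ((+ 0 , + (2 ^ n * length orbit)) ≡ ((+ 3 , + 1) ^₅ n) -₅ ((+ 3 , -1ℤ) ^₅ n))
corollary4 zero    ()
corollary4 (suc k) _ =
  orbit k , orbit-reachable k , orbit-distinct k , orbit-covers k ,
  trans (cong (λ m → + 0 , + (2 ^ suc k * m)) (length-orbit k)) (binet k)
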